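{- Let $E$ be a finite set. There is a bijection from the set of inclusion-reversing shade maps $\operatorname{Shade}:\mathcal{P}(E)\to\mathcal{P}(E)$ to the set of antimatroidal quasi-closure operators $\tau:\mathcal{P}(E)\to\mathcal{P}(E)$ which sends each $\operatorname{Shade}$ to the map $\tau$ given by $\tau(F)=F\cup(E\setminus\operatorname{Shade}F)$, and whose inverse sends each $\tau$ to the map $\operatorname{Shade}$ given by $\operatorname{Shade}F=\{e\in E\mid e\notin\tau(F\setminus\{e\})\}$.
   Context: $\mathcal{P}(E)$ is the power set of $E$. A map $S:\mathcal{P}(E)\to\mathcal{P}(E)$ is inclusion-reversing if $A\subseteq B$ implies $S(B)\subseteq S(A)$. A shade map on $E$ is a map $S:\mathcal{P}(E)\to\mathcal{P}(E)$ such that for every $F\subseteq E$ and every $u\in E\setminus S(F)$ we have $S(F\cup\{u\})=S(F)$ and $S(F\setminus\{u\})=S(F)$. A quasi-closure operator on $E$ is a map $\tau:\mathcal{P}(E)\to\mathcal{P}(E)$ with (1) $A\subseteq\tau(A)$ for all $A$; (2) $A\subseteq B$ implies $\tau(A)\subseteq\tau(B)$; (3) $\tau(\tau(A))=\tau(A)$ for all $A$. It is antimatroidal if whenever $X\subseteq E$ and $y,z$ are distinct elements of $E\setminus\tau(X)$ with $z\in\tau(X\cup\{y\})$, then $y\notin\tau(X\cup\{z\})$. -}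

module Defs where

open import Data.Nat using (ℕ)
open import Data.Fin using (Fin)
open import Data.Fin.Subset using (Subset; _∈_; _∉_; _⊆_; _∪_; _-_; ⁅_⁆; ∁)
open import Data.Bool using (not)
open import Data.Vec using (tabulate; lookup)
open import Data.Product using (_×_)
open import Relation.Binary.PropositionalEquality using (_≡_; _≢_)

-- The finite ground set E is Fin n; 𝒫(E) is Subset n; maps 𝒫(E) → 𝒫(E) are functions.
SetMap : ℕ → Set
SetMap n = Subset n → Subset n

module _ {n : ℕ} where

  InclusionReversing : SetMap n → Set
  InclusionReversing S = ∀ A B → A ⊆ B → S B ⊆ S A

  IsShadeMap : SetMap n → Set
  IsShadeMap S = ∀ (F : Subset n) (u : Fin n) → u ∉ S F →
    (S (F ∪ ⁅ u ⁆) ≡ S F) × (S (F - u) ≡ S F)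

  IsQuasiClosure : SetMap n → Set
  IsQuasiClosure τ =
    (∀ A → A ⊆ τ A) ×
    (∀ A B → A ⊆ B → τ A ⊆ τ B) ×
    (∀ A → τ (τ A) ≡ τ A)

  IsAntimatroidal : SetMap n → Set
  IsAntimatroidal τ = ∀ (X : Subset n) (y z : Fin n) → y ≢ z →
    y ∉ τ X → z ∉ τ X → z ∈ τ (X ∪ ⁅ y ⁆) → y ∉ τ (X ∪ ⁅ z ⁆)

  shadeToτ : SetMap n → SetMap n
  shadeToτ S F = F ∪ ∁ (S F)

  -- Shade F = { e ∈ E | e ∉ τ(F ∖ {e}) }   (membership e ∈ A is lookup A e ≡ inside)
  τToShade : SetMap n → SetMap n
  τToShade τ F = tabulate (λ e → not (lookup (τ (F - e)) e))

-- From a shade map S, shadeToτ S A is obtained from A by inserting, one at a time,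
-- elements outside S A; by the shade axiom none of these insertions changes S, so
-- S (shadeToτ S A) = S A, which gives idempotence, while antimatroidality follows by
-- inserting y and z in either order and then removing y again.  Conversely, for an
-- antimatroidal quasi-closure τ the exchange property makes e ∈ τ (G ∪ ⁅ u ⁆) collapse
-- to e ∈ τ G whenever u ∈ τ (G ∪ ⁅ e ⁆); hence, if u ∈ τ (F - u), the sets
-- τToShade τ H agree for all H between F - u and F ∪ ⁅ u ⁆, which is the shade axiom.
module Submission where

open import Defs
open import Data.Nat using (ℕ)
open import Data.Bool using (true; false; not)
open import Function using (_∘_)
open import Data.Fin using (Fin; _≟_)
open import Data.Fin.Subset using (Subset; _∈_; _∉_; _⊆_; _∪_; _─_; _-_; ⁅_⁆; ∁)
open import Data.Fin.Subset.Properties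
  using ( _∈?_; ⊆-refl; ⊆-trans; ⊆-antisym; x∈⁅x⁆; x∈⁅y⁆⇒x≡y; x∈∁p⇒x∉p; x∉p⇒x∈∁p
        ; ∪-assoc; ∪-comm; p⊆p∪q; q⊆p∪q; x∈p∪q⁻; p─q⊆p; x∈p∧x≢y⇒x∈p-y )
open import Data.List using (List; []; _∷_; foldr; filter; allFin)
open import Data.List.Membership.Propositional using () renaming (_∈_ to _∈ₗ_)
open import Data.List.Membership.Propositional.Properties using (∈-allFin; ∈-filter⁺)
open import Data.List.Relation.Unary.All using (All; []; _∷_)
open import Data.List.Relation.Unary.All.Properties using (all-filter)
open import Data.List.Relation.Unary.Any using (here; there)
open import Data.Product using (_×_; _,_; proj₁; proj₂)
open import Data.Sum using (_⊎_; inj₁; inj₂)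
open import Data.Vec using (_∷_; here; there; lookup)
open import Data.Vec.Properties using (lookup∘tabulate; []=⇒lookup; lookup⇒[]=)
open import Relation.Nullary using (¬_; yes; no; ¬?; contradiction)
open import Relation.Nullary.Decidable using (decidable-stable)
open import Relation.Binary.PropositionalEquality
  using (_≡_; _≢_; refl; sym; trans; cong; subst; module ≡-Reasoning)

private variable
  n : ℕ
  x y : Fin n
  p q F : Subset n

x∈p─q⇒x∉q : ∀ (p q : Subset n) → x ∈ p ─ q → x ∉ q
x∈p─q⇒x∉q (s ∷ p) (true ∷ q) () here
x∈p─q⇒x∉q (s ∷ p) (t ∷ q) (there x∈p─q) (there x∈q) = x∈p─q⇒x∉q p q x∈p─q x∈q

x∈p-y⇒x≢y : x ∈ p - y → x ≢ y
x∈p-y⇒x≢y {p = p} {y = y} x∈p-y refl = x∈p─q⇒x∉q p ⁅ y ⁆ x∈p-y (x∈⁅x⁆ y)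

p⊆q⇒p-x⊆q-x : p ⊆ q → p - x ⊆ q - x
p⊆q⇒p-x⊆q-x {p = p} {x = x} p⊆q y∈p-x =
  x∈p∧x≢y⇒x∈p-y (p⊆q (p─q⊆p p ⁅ x ⁆ y∈p-x)) (x∈p-y⇒x≢y y∈p-x)

x∉p⇒p⊆p-x : x ∉ p → p ⊆ p - x
x∉p⇒p⊆p-x x∉p y∈p = x∈p∧x≢y⇒x∈p-y y∈p λ { refl → x∉p y∈p }

x∉p⇒p∪⁅x⁆-x≡p : x ∉ p → (p ∪ ⁅ x ⁆) - x ≡ p
x∉p⇒p∪⁅x⁆-x≡p {x = x} {p = p} x∉p =
  ⊆-antisym shrink (⊆-trans (x∉p⇒p⊆p-x x∉p) (p⊆q⇒p-x⊆q-x (p⊆p∪q ⁅ x ⁆)))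
  where
  shrink : (p ∪ ⁅ x ⁆) - x ⊆ p
  shrink y∈ with x∈p∪q⁻ p ⁅ x ⁆ (p─q⊆p (p ∪ ⁅ x ⁆) ⁅ x ⁆ y∈)
  ... | inj₁ y∈p = y∈p
  ... | inj₂ y∈⁅x⁆ = contradiction (x∈⁅y⁆⇒x≡y x y∈⁅x⁆) (x∈p-y⇒x≢y y∈)

p⊆q∪⁅u⁆⇒p-e⊆q-u-e∪⁅u⁆ : ∀ {u e : Fin n} → p ⊆ q ∪ ⁅ u ⁆ → p - e ⊆ (q - u - e) ∪ ⁅ u ⁆
p⊆q∪⁅u⁆⇒p-e⊆q-u-e∪⁅u⁆ {p = p} {q = q} {u} {e} p⊆q∪⁅u⁆ {y} y∈p-e with y ≟ u
... | yes refl = q⊆p∪q (q - u - e) ⁅ u ⁆ (x∈⁅x⁆ u)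
... | no y≢u with x∈p∪q⁻ q ⁅ u ⁆ (p⊆q∪⁅u⁆ (p─q⊆p p ⁅ e ⁆ y∈p-e))
...   | inj₁ y∈q = p⊆p∪q ⁅ u ⁆ (x∈p∧x≢y⇒x∈p-y (x∈p∧x≢y⇒x∈p-y y∈q y≢u) (x∈p-y⇒x≢y y∈p-e))
...   | inj₂ y∈⁅u⁆ = contradiction (x∈⁅y⁆⇒x≡y u y∈⁅u⁆) y≢u

∪⁅⁆-swap : ∀ (p : Subset n) x y → (p ∪ ⁅ x ⁆) ∪ ⁅ y ⁆ ≡ (p ∪ ⁅ y ⁆) ∪ ⁅ x ⁆
∪⁅⁆-swap p x y = begin
  (p ∪ ⁅ x ⁆) ∪ ⁅ y ⁆  ≡⟨ ∪-assoc p ⁅ x ⁆ ⁅ y ⁆ ⟩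
  p ∪ (⁅ x ⁆ ∪ ⁅ y ⁆)  ≡⟨ cong (p ∪_) (∪-comm ⁅ x ⁆ ⁅ y ⁆) ⟩
  p ∪ (⁅ y ⁆ ∪ ⁅ x ⁆)  ≡⟨ sym (∪-assoc p ⁅ y ⁆ ⁅ x ⁆) ⟩
  (p ∪ ⁅ y ⁆) ∪ ⁅ x ⁆  ∎
  where open ≡-Reasoning

∪⁅⁆⊆ : ∀ {r} → p ⊆ r → x ∈ r → p ∪ ⁅ x ⁆ ⊆ r
∪⁅⁆⊆ {p = p} {x = x} p⊆r x∈r y∈ with x∈p∪q⁻ p ⁅ x ⁆ y∈
... | inj₁ y∈p   = p⊆r y∈p
... | inj₂ y∈⁅x⁆ = subst (_∈ _) (sym (x∈⁅y⁆⇒x≡y x y∈⁅x⁆)) x∈r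

p⊆p-x∪⁅x⁆ : p ⊆ (p - x) ∪ ⁅ x ⁆
p⊆p-x∪⁅x⁆ {p = p} {x = x} {y} y∈p with y ≟ x
... | yes refl = q⊆p∪q (p - x) ⁅ x ⁆ (x∈⁅x⁆ x)
... | no y≢x   = p⊆p∪q ⁅ x ⁆ (x∈p∧x≢y⇒x∈p-y y∈p y≢x)

∉-stable : ¬ x ∉ p → x ∈ p
∉-stable {x = x} {p = p} = decidable-stable (x ∈? p)

insertAll : List (Fin n) → Subset n → Subset n
insertAll xs p = foldr (λ x q → q ∪ ⁅ x ⁆) p xs

p⊆insertAll : ∀ xs → p ⊆ insertAll xs p
p⊆insertAll []       = ⊆-refl
p⊆insertAll (x ∷ xs) = ⊆-trans (p⊆insertAll xs) (p⊆p∪q ⁅ x ⁆)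

x∈insertAll : ∀ xs → x ∈ₗ xs → x ∈ insertAll xs p
x∈insertAll (x ∷ xs) (here refl)  = q⊆p∪q _ ⁅ x ⁆ (x∈⁅x⁆ x)
x∈insertAll (y ∷ xs) (there x∈xs) = p⊆p∪q ⁅ y ⁆ (x∈insertAll xs x∈xs)

module _ (S : SetMap n) {F : Subset n} where

  ∈shadeToτ : x ∈ F ⊎ x ∉ S F → x ∈ shadeToτ S F
  ∈shadeToτ (inj₁ x∈F) = p⊆p∪q _ x∈F
  ∈shadeToτ (inj₂ x∉SF) = q⊆p∪q F _ (x∉p⇒x∈∁p x∉SF)

  ∈shadeToτ⁻ : x ∈ shadeToτ S F → x ∈ F ⊎ x ∉ S F
  ∈shadeToτ⁻ x∈ with x∈p∪q⁻ F (∁ (S F)) x∈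
  ... | inj₁ x∈F = inj₁ x∈F
  ... | inj₂ x∈∁SF = inj₂ (x∈∁p⇒x∉p x∈∁SF)

  ∉shadeToτ⁻ : x ∉ shadeToτ S F → x ∉ F × x ∈ S F
  ∉shadeToτ⁻ x∉ = x∉ ∘ ∈shadeToτ ∘ inj₁ , ∉-stable (x∉ ∘ ∈shadeToτ ∘ inj₂)

module _ (τ : SetMap n) {F : Subset n} where

  ∈τToShade : x ∉ τ (F - x) → x ∈ τToShade τ F
  ∈τToShade {x = x} x∉ with lookup (τ (F - x)) x in eq
  ... | true = contradiction (lookup⇒[]= x _ eq) x∉
  ... | false = lookup⇒[]= x _ (trans (lookup∘tabulate _ x) (cong not eq))

  ∈τToShade⁻ : x ∈ τToShade τ F → x ∉ τ (F - x)
  ∈τToShade⁻ {x = x} x∈ x∈τ = contradiction not-true≡true λ ()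
    where
    not-true≡true : not true ≡ true
    not-true≡true =
      trans (cong not (sym ([]=⇒lookup x∈τ))) (trans (sym (lookup∘tabulate _ x)) ([]=⇒lookup x∈))

module _ {S : SetMap n} (shade : IsShadeMap S) where

  shade-insertAll : ∀ {A} xs → All (_∉ S A) xs → S (insertAll xs A) ≡ S A
  shade-insertAll         []       []             = refl
  shade-insertAll {A = A} (x ∷ xs) (x∉SA ∷ xs∉SA) =
    trans (proj₁ (shade (insertAll xs A) x (subst (x ∉_) (sym ih) x∉SA))) ih
    where
    ih : S (insertAll xs A) ≡ S A
    ih = shade-insertAll xs xs∉SA

  shade-⊆-shadeToτ : InclusionReversing S → ∀ A → S A ⊆ S (shadeToτ S A)
  shade-⊆-shadeToτ reversing A =
    subst (_⊆ S (shadeToτ S A)) (shade-insertAll outside (all-filter _ (allFin n)))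
      (reversing _ _ shadeToτ⊆insertAll)
    where
    outside : List (Fin n)
    outside = filter (λ x → ¬? (x ∈? S A)) (allFin n)
    shadeToτ⊆insertAll : shadeToτ S A ⊆ insertAll outside A
    shadeToτ⊆insertAll {x} x∈ with ∈shadeToτ⁻ S x∈
    ... | inj₁ x∈A  = p⊆insertAll outside x∈A
    ... | inj₂ x∉SA = x∈insertAll outside (∈-filter⁺ _ (∈-allFin x) x∉SA)

module _ {S : SetMap n} where

  shadeToτ-extensive : ∀ A → A ⊆ shadeToτ S A
  shadeToτ-extensive A = ∈shadeToτ S ∘ inj₁

  shadeToτ-monotone : InclusionReversing S → ∀ A B → A ⊆ B → shadeToτ S A ⊆ shadeToτ S B
  shadeToτ-monotone reversing A B A⊆B x∈ with ∈shadeToτ⁻ S x∈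
  ... | inj₁ x∈A  = ∈shadeToτ S (inj₁ (A⊆B x∈A))
  ... | inj₂ x∉SA = ∈shadeToτ S (inj₂ (x∉SA ∘ reversing A B A⊆B))

  shadeToτ-idempotent : IsShadeMap S → InclusionReversing S →
                        ∀ A → shadeToτ S (shadeToτ S A) ≡ shadeToτ S A
  shadeToτ-idempotent shade reversing A =
    ⊆-antisym shrink (shadeToτ-extensive (shadeToτ S A))
    where
    shrink : shadeToτ S (shadeToτ S A) ⊆ shadeToτ S A
    shrink x∈ with ∈shadeToτ⁻ S x∈
    ... | inj₁ x∈τA   = x∈τA
    ... | inj₂ x∉SτA = ∈shadeToτ S (inj₂ (x∉SτA ∘ shade-⊆-shadeToτ shade reversing A))

  ∉shade-∪⁅⁆ : x ∉ F → x ≢ y → x ∈ shadeToτ S (F ∪ ⁅ y ⁆) → x ∉ S (F ∪ ⁅ y ⁆)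
  ∉shade-∪⁅⁆ {F = F} {y = y} x∉F x≢y x∈ with ∈shadeToτ⁻ S x∈
  ... | inj₂ x∉S = x∉S
  ... | inj₁ x∈F∪⁅y⁆ with x∈p∪q⁻ F ⁅ y ⁆ x∈F∪⁅y⁆
  ...   | inj₁ x∈F   = contradiction x∈F x∉F
  ...   | inj₂ x∈⁅y⁆ = contradiction (x∈⁅y⁆⇒x≡y y x∈⁅y⁆) x≢y

  shadeToτ-antimatroidal : IsShadeMap S → IsAntimatroidal (shadeToτ S)
  shadeToτ-antimatroidal shade X y z y≢z y∉τX z∉τX z∈τX∪⁅y⁆ y∈τX∪⁅z⁆ = y∉SX y∈SX
    where
    y∉X : y ∉ X
    y∉X = proj₁ (∉shadeToτ⁻ S y∉τX)
    y∈SX : y ∈ S X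
    y∈SX = proj₂ (∉shadeToτ⁻ S y∉τX)
    z∉SX∪⁅y⁆ : z ∉ S (X ∪ ⁅ y ⁆)
    z∉SX∪⁅y⁆ = ∉shade-∪⁅⁆ (proj₁ (∉shadeToτ⁻ S z∉τX)) (y≢z ∘ sym) z∈τX∪⁅y⁆
    y∉SX∪⁅z⁆ : y ∉ S (X ∪ ⁅ z ⁆)
    y∉SX∪⁅z⁆ = ∉shade-∪⁅⁆ y∉X y≢z y∈τX∪⁅z⁆
    SX∪⁅y⁆≡SX∪⁅z⁆ : S (X ∪ ⁅ y ⁆) ≡ S (X ∪ ⁅ z ⁆)
    SX∪⁅y⁆≡SX∪⁅z⁆ = begin
      S (X ∪ ⁅ y ⁆)            ≡⟨ sym (proj₁ (shade _ z z∉SX∪⁅y⁆)) ⟩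
      S ((X ∪ ⁅ y ⁆) ∪ ⁅ z ⁆)  ≡⟨ cong S (∪⁅⁆-swap X y z) ⟩
      S ((X ∪ ⁅ z ⁆) ∪ ⁅ y ⁆)  ≡⟨ proj₁ (shade _ y y∉SX∪⁅z⁆) ⟩
      S (X ∪ ⁅ z ⁆)            ∎
      where open ≡-Reasoning
    y∉SX∪⁅y⁆ : y ∉ S (X ∪ ⁅ y ⁆)
    y∉SX∪⁅y⁆ = subst (y ∉_) (sym SX∪⁅y⁆≡SX∪⁅z⁆) y∉SX∪⁅z⁆
    SX≡SX∪⁅y⁆ : S X ≡ S (X ∪ ⁅ y ⁆)
    SX≡SX∪⁅y⁆ = trans (cong S (sym (x∉p⇒p∪⁅x⁆-x≡p y∉X))) (proj₂ (shade _ y y∉SX∪⁅y⁆))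
    y∉SX : y ∉ S X
    y∉SX = subst (y ∉_) (sym SX≡SX∪⁅y⁆) y∉SX∪⁅y⁆

  τToShade∘shadeToτ : IsShadeMap S → InclusionReversing S → ∀ F → τToShade (shadeToτ S) F ≡ S F
  τToShade∘shadeToτ shade reversing F = ⊆-antisym ⊆S S⊆
    where
    ⊆S : τToShade (shadeToτ S) F ⊆ S F
    ⊆S {e} e∈ = ∉-stable λ e∉SF →
      contradiction (subst (e ∈_) (proj₂ (shade F e e∉SF)) e∈SF-e) e∉SF
      where
      e∈SF-e : e ∈ S (F - e)
      e∈SF-e = proj₂ (∉shadeToτ⁻ S (∈τToShade⁻ (shadeToτ S) e∈))
    S⊆ : S F ⊆ τToShade (shadeToτ S) F
    S⊆ {e} e∈SF = ∈τToShade (shadeToτ S) e∉τF-e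
      where
      e∉τF-e : e ∉ shadeToτ S (F - e)
      e∉τF-e e∈ with ∈shadeToτ⁻ S e∈
      ... | inj₁ e∈F-e    = x∈p-y⇒x≢y e∈F-e refl
      ... | inj₂ e∉SF-e = e∉SF-e (reversing (F - e) F (p─q⊆p F ⁅ e ⁆) e∈SF)

module _ {τ : SetMap n} (closure : IsQuasiClosure τ) where

  private
    extensive : ∀ A → A ⊆ τ A
    extensive = proj₁ closure
    monotone : ∀ A B → A ⊆ B → τ A ⊆ τ B
    monotone = proj₁ (proj₂ closure)
    idempotent : ∀ A → τ (τ A) ≡ τ A
    idempotent = proj₂ (proj₂ closure)

  antimatroidal-exchange : IsAntimatroidal τ → ∀ {G : Subset n} {e u} → e ≢ u →
                           u ∈ τ (G ∪ ⁅ e ⁆) → e ∈ τ (G ∪ ⁅ u ⁆) → e ∈ τ G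
  antimatroidal-exchange anti {G} {e} {u} e≢u u∈τG∪⁅e⁆ e∈τG∪⁅u⁆ with e ∈? τ G
  ... | yes e∈τG = e∈τG
  ... | no e∉τG with u ∈? τ G
  ...   | yes u∈τG = contradiction e∈τG e∉τG
    where
    e∈τG : e ∈ τ G
    e∈τG = subst (e ∈_) (idempotent G) (monotone _ _ (∪⁅⁆⊆ (extensive G) u∈τG) e∈τG∪⁅u⁆)
  ...   | no u∉τG = contradiction e∈τG∪⁅u⁆ (anti G e u e≢u e∉τG u∉τG u∈τG∪⁅e⁆)

  τToShade-antitone : InclusionReversing (τToShade τ)
  τToShade-antitone A B A⊆B {e} e∈ =
    ∈τToShade τ (∈τToShade⁻ τ e∈ ∘ monotone (A - e) (B - e) (p⊆q⇒p-x⊆q-x A⊆B))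

  module _ (anti : IsAntimatroidal τ) {F : Subset n} {u : Fin n} (u∈τF-u : u ∈ τ (F - u)) where

    -- For e ≢ u, both H - e and H′ - e lie between G = F - u - e and G ∪ ⁅ u ⁆.
    τToShade-⊆-between : ∀ {H H′} → F - u ⊆ H → F - u ⊆ H′ → H′ ⊆ F ∪ ⁅ u ⁆ →
                         τToShade τ H ⊆ τToShade τ H′
    τToShade-⊆-between {H} {H′} F-u⊆H F-u⊆H′ H′⊆F∪⁅u⁆ {e} e∈ShH with e ≟ u
    ... | yes refl = contradiction u∈τH-u (∈τToShade⁻ τ e∈ShH)
      where
      u∈τH-u : u ∈ τ (H - u)
      u∈τH-u = monotone _ _ F-u⊆H-u u∈τF-u
        where
        F-u⊆H-u : F - u ⊆ H - u
        F-u⊆H-u = ⊆-trans (x∉p⇒p⊆p-x (λ u∈ → x∈p-y⇒x≢y u∈ refl)) (p⊆q⇒p-x⊆q-x F-u⊆H)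
    ... | no e≢u = ∈τToShade τ λ e∈τH′-e →
        ∈τToShade⁻ τ e∈ShH (monotone G (H - e) (p⊆q⇒p-x⊆q-x F-u⊆H)
          (antimatroidal-exchange anti e≢u u∈τG∪⁅e⁆
            (monotone (H′ - e) _ (p⊆q∪⁅u⁆⇒p-e⊆q-u-e∪⁅u⁆ H′⊆F∪⁅u⁆) e∈τH′-e)))
      where
      G : Subset n
      G = F - u - e
      u∈τG∪⁅e⁆ : u ∈ τ (G ∪ ⁅ e ⁆)
      u∈τG∪⁅e⁆ = monotone (F - u) _ p⊆p-x∪⁅x⁆ u∈τF-u

    τToShade-≡-between : ∀ {H} → F - u ⊆ H → H ⊆ F ∪ ⁅ u ⁆ → τToShade τ H ≡ τToShade τ F
    τToShade-≡-between F-u⊆H H⊆F∪⁅u⁆ =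
      ⊆-antisym (τToShade-⊆-between F-u⊆H F-u⊆F (p⊆p∪q ⁅ u ⁆))
                (τToShade-⊆-between F-u⊆F F-u⊆H H⊆F∪⁅u⁆)
      where
      F-u⊆F : F - u ⊆ F
      F-u⊆F = p─q⊆p F ⁅ u ⁆

  τToShade-shade : IsAntimatroidal τ → IsShadeMap (τToShade τ)
  τToShade-shade anti F u u∉ShF =
    τToShade-≡-between anti u∈τF-u (⊆-trans F-u⊆F (p⊆p∪q ⁅ u ⁆)) ⊆-refl ,
    τToShade-≡-between anti u∈τF-u ⊆-refl (⊆-trans F-u⊆F (p⊆p∪q ⁅ u ⁆))
    where
    F-u⊆F : F - u ⊆ F
    F-u⊆F = p─q⊆p F ⁅ u ⁆
    u∈τF-u : u ∈ τ (F - u)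
    u∈τF-u = ∉-stable (u∉ShF ∘ ∈τToShade τ)

  shadeToτ∘τToShade : ∀ F → shadeToτ (τToShade τ) F ≡ τ F
  shadeToτ∘τToShade F = ⊆-antisym ⊆τ τ⊆
    where
    ⊆τ : shadeToτ (τToShade τ) F ⊆ τ F
    ⊆τ {x} x∈ with ∈shadeToτ⁻ (τToShade τ) x∈
    ... | inj₁ x∈F    = extensive F x∈F
    ... | inj₂ x∉ShF = monotone (F - x) F (p─q⊆p F ⁅ x ⁆) (∉-stable (x∉ShF ∘ ∈τToShade τ))
    τ⊆ : τ F ⊆ shadeToτ (τToShade τ) F
    τ⊆ {x} x∈τF with x ∈? F
    ... | yes x∈F = ∈shadeToτ (τToShade τ) (inj₁ x∈F)
    ... | no x∉F  = ∈shadeToτ (τToShade τ)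
                      (inj₂ λ x∈ShF → ∈τToShade⁻ τ x∈ShF (monotone F (F - x) (x∉p⇒p⊆p-x x∉F) x∈τF))

theorem4p25 : (n : ℕ) →
      (∀ (S : SetMap n) → IsShadeMap S → InclusionReversing S →
        IsQuasiClosure (shadeToτ S) × IsAntimatroidal (shadeToτ S))
    × (∀ (τ : SetMap n) → IsQuasiClosure τ → IsAntimatroidal τ →
        IsShadeMap (τToShade τ) × InclusionReversing (τToShade τ))
    × (∀ (S : SetMap n) → IsShadeMap S → InclusionReversing S →
        ∀ F → τToShade (shadeToτ S) F ≡ S F)
    × (∀ (τ : SetMap n) → IsQuasiClosure τ → IsAntimatroidal τ →
        ∀ F → shadeToτ (τToShade τ) F ≡ τ F)
theorem4p25 n =
    (λ S shade reversing →
        (shadeToτ-extensive , shadeToτ-monotone reversing , shadeToτ-idempotent shade reversing)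
      , shadeToτ-antimatroidal shade)
  , (λ τ closure anti → τToShade-shade closure anti , τToShade-antitone closure)
  , (λ S shade reversing → τToShade∘shadeToτ shade reversing)
  , (λ τ closure _ → shadeToτ∘τToShade closure)
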